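{- (i) For every stump $\sigma$ and all $\delta,\alpha\in\mathcal N$, if $\sigma$ secures that $\alpha$ belongs to $\mathit{Almost}^\ast(En_\delta)$, then $\alpha\in\mathbb P(\sigma,En_\delta)$. (ii) For all $\delta,\alpha$, if $\alpha\in\mathit{Almost}^\ast(En_\delta)$, then there exists a stump $\sigma$ such that $\alpha\in\mathbb P(\sigma,En_\delta)$. (iii) For all $\delta$, the set $\mathit{Almost}^\ast(En_\delta)$ coincides with $\bigcup_{\sigma\in\mathbf{Stp}}\mathbb P(\sigma,En_\delta)$. (iv) For all $\beta,\delta$: if for every $s$, $\beta(s)=0$ iff $\beta(s*\langle n\rangle)=0$ for some $n$, and $F_\beta\subseteq\mathit{Almost}^\ast(En_\delta)$, then there exists a stump $\tau$ with $F_\beta\subseteq\mathbb P(\tau,En_\delta)$. (v) The set $\mathbf{ACS}$ coincides with $\bigcup_{\sigma\in\mathbf{Stp}}\mathbf{PCS}_\sigma$.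
   Context: Framework: Brouwer's intuitionistic analysis (intuitionistic logic, countable choice, Brouwer's Continuity Principle, axioms of continuous choice, Brouwer's Thesis on Bars, Fan Theorem). $\mathcal N=\mathbb N^{\mathbb N}$; finite sequences coded by numbers ($\langle\,\rangle=0$), $\overline\alpha n$ initial part of length $n$, $\overline si$ initial part of $s$ of length $i$, $*$ concatenation, $\alpha^m(k)=\alpha(\langle m\rangle*k)$; $\alpha\#\beta$ iff $\exists n\,\alpha(n)\neq\beta(n)$. $F_\beta=\{\alpha:\forall n\,\beta(\overline\alpha n)=0\}$. Stumps: $\mathbf{Stp}$ is the least set containing every $\sigma$ with $\sigma(0)\ne0$ (empty stumps) and containing $\sigma$ whenever $\sigma(0)=0$ and all $\sigma^n\in\mathbf{Stp}$; $\sigma$ admits $s$ iff $\sigma(\overline si)=0$ for all $i\le\mathit{length}(s)$. $En_\delta=\{\delta^n:n\in\mathbb N\}$. $\mathit{Almost}^\ast(En_\delta)$ = set of $\alpha$ such that for every $\gamma$ there is $n$ with $\overline\alpha(\gamma(n))=\overline{\delta^n}(\gamma(n))$. $\sigma$ secures that $\alpha\in\mathit{Almost}^\ast(En_\delta)$ iff for every $\gamma$ there is $n$ such that $\overline\gamma(n+1)$ is admitted by $\sigma$ and $\overline\alpha(\gamma(n))=\overline{\delta^n}(\gamma(n))$. Perhapsive extensions, by induction on stumps: $\mathbb P(\sigma,X)=X$ if $\sigma$ is empty; for non-empty $\sigma$, $\mathbb P(\sigma,X)$ is the set of $\alpha$ for which there is $\beta\in X$ such that if $\alpha\#\beta$ then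 $\alpha\in\mathbb P(\sigma^m,X)$ for some $m$. $\beta$ is a spread-law iff $\forall s[\beta(s)=0\leftrightarrow\exists n\,\beta(s*\langle n\rangle)=0]$. $\mathbf{PCS}_\sigma$ = set of spread-laws $\beta$ such that $F_\beta\subseteq\mathbb P(\sigma,En_\delta)$ for some $\delta$; $\mathbf{ACS}$ = set of spread-laws $\beta$ such that $F_\beta\subseteq\mathit{Almost}^\ast(En_\delta)$ for some $\delta$. -}

module Defs where

open import Data.Nat using (ℕ; zero; suc; _≤_)
open import Data.List using (List; []; _∷_; _++_; [_]; length; take)
open import Data.Product using (Σ; _×_; _,_)
open import Relation.Binary.PropositionalEquality using (_≡_; _≢_)

Baire : Set
Baire = ℕ → ℕ

-- Finite sequences are represented directly as lists (instead of via a
-- numerical coding); ⟨⟩ is [], s * t is s ++ t, ⟨m⟩ * s is m ∷ s.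
Seq : Set
Seq = List ℕ

initSeg : Baire → ℕ → Seq
initSeg α zero = []
initSeg α (suc n) = α 0 ∷ initSeg (λ k → α (suc k)) n

_^_ : (Seq → ℕ) → ℕ → (Seq → ℕ)
(σ ^ m) s = σ (m ∷ s)

_#_ : Baire → Baire → Set
α # β = Σ ℕ (λ n → α n ≢ β n)

F : (Seq → ℕ) → Baire → Set
F β α = ∀ n → β (initSeg α n) ≡ 0

data Stp : (Seq → ℕ) → Set where
  empty    : ∀ {σ} → σ [] ≢ 0 → Stp σ
  nonempty : ∀ {σ} → σ [] ≡ 0 → (∀ n → Stp (σ ^ n)) → Stp σ

Admits : (Seq → ℕ) → Seq → Set
Admits σ s = ∀ i → i ≤ length s → σ (take i s) ≡ 0

-- En_δ = { δ^n | n ∈ ℕ }; the enumeration δ is given as the map n ↦ δ^n.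
-- Membership is extensional (pointwise equality).
En : (ℕ → Baire) → Baire → Set
En δ β = Σ ℕ (λ n → ∀ k → β k ≡ δ n k)

Almost* : (ℕ → Baire) → Baire → Set
Almost* δ α = ∀ (γ : Baire) → Σ ℕ (λ n → initSeg α (γ n) ≡ initSeg (δ n) (γ n))

Secures : (Seq → ℕ) → (ℕ → Baire) → Baire → Set
Secures σ δ α = ∀ (γ : Baire) → Σ ℕ (λ n →
  Admits σ (initSeg γ (suc n)) × (initSeg α (γ n) ≡ initSeg (δ n) (γ n)))

ℙ : (σ : Seq → ℕ) → Stp σ → (Baire → Set) → Baire → Set
ℙ σ (empty _) X α = X α
ℙ σ (nonempty _ h) X α =
  Σ Baire (λ β → X β × (α # β → Σ ℕ (λ m → ℙ (σ ^ m) (h m) X α)))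

SpreadLaw : (Seq → ℕ) → Set
SpreadLaw β = ∀ (s : Seq) →
  (β s ≡ 0 → Σ ℕ (λ n → β (s ++ [ n ]) ≡ 0)) × (Σ ℕ (λ n → β (s ++ [ n ]) ≡ 0) → β s ≡ 0)

PCS : (σ : Seq → ℕ) → Stp σ → (Seq → ℕ) → Set
PCS σ s β = SpreadLaw β × Σ (ℕ → Baire) (λ δ → ∀ α → F β α → ℙ σ s (En δ) α)

ACS : (Seq → ℕ) → Set
ACS β = SpreadLaw β × Σ (ℕ → Baire) (λ δ → ∀ α → F β α → Almost* δ α)

-- Brouwer's Thesis on Bars (for decidable bars B = {s | B(s) = 0}):
-- every bar in 𝒩 is "measured" by a stump.
BrouwerThesis : Set
BrouwerThesis = ∀ (B : Seq → ℕ) →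
  (∀ (γ : Baire) → Σ ℕ (λ n → B (initSeg γ n) ≡ 0)) →
  Σ (Seq → ℕ) (λ σ → Stp σ ×
    (∀ (γ : Baire) → Σ ℕ (λ n → Admits σ (initSeg γ n) × (B (initSeg γ n) ≡ 0))))

module Submission where

-- If σ secures α ∈ Almost*(En δ) and
-- α(p) ≠ δ⁰(p), then no γ starting with p+1 can be secured at n = 0, so σ^(p+1) secures
-- α ∈ Almost*(En (δ ∘ suc)); conversely, following the apartness witnesses down a stump
-- reaches a leaf, where α is some δⁿ.
--
-- For (iv), retract 𝒩 onto F_β along the spread-law and read a sequence ε of codes of pairs
-- (a_j, g_j) as a point ρ(a) ∈ F_β together with a sequence g.  Since ρ(a) ∈ Almost*(En δ),
-- the decidable B(s) = 0 ⇔ "some position j of s has g_j ≤ |s| and ρ(a) agrees with δ^j below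
-- g_j" is a bar, and Brouwer's Thesis yields a stump τ measuring it.  For α ∈ F_β we descend τ:
-- at a node h propose δ^|h|, and when α(p) ≠ δ^|h|(p) move on to the code of (α(|h|), p+1),
-- a position that can never be a hit along α.  (ii) is (iv) for the spread-law of {α}.

open import Defs
open import Data.Nat using (ℕ; zero; suc; _+_; _≤_; _<_; z≤n; s≤s; _≟_; _≤?_)
open import Data.Nat.Properties
  using ( ≤-refl; ≤-trans; m≤m+n; m≤n+m; n≤1+n; m<1+n⇒m<n∨m≡n
        ; +-suc; +-identityʳ; suc-injective; anyUpTo?)
open import Data.List using ([]; _∷_; _++_; [_]; length)
open import Data.List.Properties
  using (∷-injectiveˡ; ∷-injectiveʳ; ∷ʳ-injectiveˡ; ++-assoc; ++-identityʳ; ≡-dec)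
open import Data.Product using (Σ; _×_; _,_; proj₁; proj₂)
open import Data.Sum using (inj₁; inj₂)
open import Data.Empty using (⊥-elim)
open import Relation.Nullary using (Dec; yes; no)
open import Relation.Nullary.Decidable using (_×-dec_)
open import Relation.Binary.PropositionalEquality
  using (_≡_; _≢_; refl; sym; trans; cong; cong₂; subst)

zeroIf : {P : Set} → Dec P → ℕ
zeroIf (yes _) = 0
zeroIf (no _)  = 1

zeroIf-sound : {P : Set} (d : Dec P) → zeroIf d ≡ 0 → P
zeroIf-sound (yes p) _ = p

zeroIf-complete : {P : Set} (d : Dec P) → P → zeroIf d ≡ 0
zeroIf-complete (yes _) _ = refl
zeroIf-complete (no ¬p) p = ⊥-elim (¬p p)

tail : Baire → Baire
tail α k = α (suc k)

cons : ℕ → Baire → Baire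
cons m α zero    = m
cons m α (suc k) = α k

length-snoc : ∀ (s : Seq) x → length (s ++ [ x ]) ≡ suc (length s)
length-snoc []      x = refl
length-snoc (_ ∷ s) x = cong suc (length-snoc s x)

initSeg-cong : ∀ {a b : Baire} n → (∀ k → k < n → a k ≡ b k) → initSeg a n ≡ initSeg b n
initSeg-cong zero    _ = refl
initSeg-cong (suc n) e = cong₂ _∷_ (e 0 (s≤s z≤n)) (initSeg-cong n (λ k k<n → e (suc k) (s≤s k<n)))

initSeg-agree : ∀ (a b : Baire) {n k} → initSeg a n ≡ initSeg b n → k < n → a k ≡ b k
initSeg-agree a b {suc n} {zero}  e _         = ∷-injectiveˡ e
initSeg-agree a b {suc n} {suc k} e (s≤s k<n) = initSeg-agree (tail a) (tail b) (∷-injectiveʳ e) k<n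

initSeg-shorten : ∀ (a b : Baire) {m n} → m ≤ n →
                  initSeg a n ≡ initSeg b n → initSeg a m ≡ initSeg b m
initSeg-shorten a b m≤n e = initSeg-cong _ (λ k k<m → initSeg-agree a b e (≤-trans k<m m≤n))

length-initSeg : ∀ (a : Baire) n → length (initSeg a n) ≡ n
length-initSeg a zero    = refl
length-initSeg a (suc n) = cong suc (length-initSeg (tail a) n)

initSeg-snoc : ∀ (a : Baire) n → initSeg a n ++ [ a n ] ≡ initSeg a (suc n)
initSeg-snoc a zero    = refl
initSeg-snoc a (suc n) = cong (a 0 ∷_) (initSeg-snoc (tail a) n)

initSeg-≢⇒# : ∀ (a b : Baire) n → initSeg a n ≢ initSeg b n → a # b
initSeg-≢⇒# a b zero    a≢b = ⊥-elim (a≢b refl)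
initSeg-≢⇒# a b (suc n) a≢b with a 0 ≟ b 0
... | no a₀≢b₀ = 0 , a₀≢b₀
... | yes a₀≡b₀ with initSeg-≢⇒# (tail a) (tail b) n (λ e → a≢b (cong₂ _∷_ a₀≡b₀ e))
...   | p , aₚ≢bₚ = suc p , aₚ≢bₚ

pad : Seq → Baire
pad []      k       = 0
pad (x ∷ s) zero    = x
pad (x ∷ s) (suc k) = pad s k

pad-initSeg : ∀ (a : Baire) {n k} → k < n → pad (initSeg a n) k ≡ a k
pad-initSeg a {suc n} {zero}  _         = refl
pad-initSeg a {suc n} {suc k} (s≤s k<n) = pad-initSeg (tail a) k<n

pad-++ : ∀ s t {k} → k < length s → pad (s ++ t) k ≡ pad s k
pad-++ (x ∷ s) t {zero}  _         = refl
pad-++ (x ∷ s) t {suc k} (s≤s k<s) = pad-++ s t k<s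

pad-snoc : ∀ s x → pad (s ++ [ x ]) (length s) ≡ x
pad-snoc []      x = refl
pad-snoc (_ ∷ s) x = pad-snoc s x

-- Enumeration of ℕ × ℕ along the anti-diagonals a + g = d.
nextPair : ℕ × ℕ → ℕ × ℕ
nextPair (a , zero)  = 0 , suc a
nextPair (a , suc g) = suc a , g

unpair : ℕ → ℕ × ℕ
unpair zero    = 0 , 0
unpair (suc c) = nextPair (unpair c)

unpair-reaches : ∀ d a g → a + g ≡ d → Σ ℕ λ c → unpair c ≡ (a , g)
unpair-reaches d       zero    zero    _ = 0 , refl
unpair-reaches zero    zero    (suc g) ()
unpair-reaches (suc d) zero    (suc g) e
  with c , u ← unpair-reaches d g zero (trans (+-identityʳ g) (suc-injective e)) = suc c , cong nextPair u
unpair-reaches d       (suc a) g       e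
  with c , u ← unpair-reaches d a (suc g) (trans (+-suc a g) e) = suc c , cong nextPair u

pair : ℕ → ℕ → ℕ
pair a g = proj₁ (unpair-reaches _ a g refl)

unpair-pair : ∀ a g → unpair (pair a g) ≡ (a , g)
unpair-pair a g = proj₂ (unpair-reaches _ a g refl)

first second : ℕ → ℕ
first c  = proj₁ (unpair c)
second c = proj₂ (unpair c)

Bar : (Seq → ℕ) → Set
Bar B = ∀ (γ : Baire) → Σ ℕ λ n → B (initSeg γ n) ≡ 0

Measures : (Seq → ℕ) → (Seq → ℕ) → Set
Measures σ B = ∀ (γ : Baire) → Σ ℕ λ n → Admits σ (initSeg γ n) × B (initSeg γ n) ≡ 0

admits-^ : ∀ σ m s → Admits σ (m ∷ s) → Admits (σ ^ m) s
admits-^ σ m s adm i i≤ = adm (suc i) (s≤s i≤)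

measures-root : ∀ {σ B} → Measures σ B → σ [] ≡ 0
measures-root K = proj₁ (proj₂ (K (λ _ → 0))) 0 z≤n

measures-^ : ∀ {σ B} → Measures σ B → B [] ≢ 0 → ∀ m → Measures (σ ^ m) (λ s → B (m ∷ s))
measures-^ {σ} K B[]≢0 m γ with K (cons m γ)
... | zero  , _   , B≡0 = ⊥-elim (B[]≢0 B≡0)
... | suc n , adm , B≡0 = n , admits-^ σ m (initSeg γ n) adm , B≡0

measures-resp : ∀ {σ B B′} → (∀ s → B s ≡ B′ s) → Measures σ B → Measures σ B′
measures-resp B≗B′ K γ with n , adm , B≡0 ← K γ = n , adm , trans (sym (B≗B′ _)) B≡0

ℙ-mono : ∀ {X Y : Baire → Set} → (∀ {α} → X α → Y α) →
         ∀ {σ} (S : Stp σ) {α} → ℙ σ S X α → ℙ σ S Y α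
ℙ-mono X⊆Y (empty _)      x                = X⊆Y x
ℙ-mono X⊆Y (nonempty _ S) (β , β∈X , down) =
  β , X⊆Y β∈X , λ α#β → let m , P = down α#β in m , ℙ-mono X⊆Y (S m) P

En-tail : ∀ {δ α} → En (λ n → δ (suc n)) α → En δ α
En-tail (n , e) = suc n , e

secures-^ : ∀ {σ δ α p} → Secures σ δ α → α p ≢ δ 0 p →
            Secures (σ ^ suc p) (λ n → δ (suc n)) α
secures-^ {σ} {δ} {α} {p} sec αₚ≢ γ with sec (cons (suc p) γ)
... | zero  , _   , agree = ⊥-elim (αₚ≢ (initSeg-agree α (δ 0) agree ≤-refl))
... | suc n , adm , agree = n , admits-^ σ (suc p) (initSeg γ (suc n)) adm , agree

secures⇒ℙ : ∀ {σ} (S : Stp σ) {δ α} → Secures σ δ α → ℙ σ S (En δ) α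
secures⇒ℙ (empty σ≢0) sec = ⊥-elim (σ≢0 (proj₁ (proj₂ (sec (λ _ → 0))) 0 z≤n))
secures⇒ℙ {σ} (nonempty _ S) {δ} {α} sec =
  δ 0 , (0 , λ _ → refl) ,
  λ (p , αₚ≢) → suc p ,
    ℙ-mono En-tail (S (suc p)) (secures⇒ℙ (S (suc p)) (secures-^ {σ} {δ} {α} sec αₚ≢))

ℙ⇒Almost* : ∀ {σ} (S : Stp σ) {δ α} → ℙ σ S (En δ) α → Almost* δ α
ℙ⇒Almost* (empty _) (k , α≗δₖ) γ = k , initSeg-cong _ (λ j _ → α≗δₖ j)
ℙ⇒Almost* (nonempty _ S) {δ} {α} (β , (k , β≗δₖ) , down) γ
  with ≡-dec _≟_ (initSeg α (γ k)) (initSeg (δ k) (γ k))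
... | yes agree = k , agree
... | no differ with p , αₚ≢ ← initSeg-≢⇒# α (δ k) (γ k) differ
                with m , P ← down (p , λ αₚ≡βₚ → αₚ≢ (trans αₚ≡βₚ (β≗δₖ p)))
                = ℙ⇒Almost* (S m) P γ

module Retraction (β : Seq → ℕ) (spread : SpreadLaw β) where

  InTree : Seq → Set
  InTree s = β s ≡ 0

  child : Seq → ℕ
  child s with β s ≟ 0
  ... | yes s∈ = proj₁ (proj₁ (spread s) s∈)
  ... | no _   = 0

  child-∈ : ∀ s → InTree s → InTree (s ++ [ child s ])
  child-∈ s s∈ with β s ≟ 0
  ... | yes s∈′ = proj₂ (proj₁ (spread s) s∈′)
  ... | no s∉   = ⊥-elim (s∉ s∈)

  next : Seq → ℕ → ℕ
  next s x with β (s ++ [ x ]) ≟ 0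
  ... | yes _ = x
  ... | no _  = child s

  next-∈ : ∀ s x → InTree s → InTree (s ++ [ next s x ])
  next-∈ s x s∈ with β (s ++ [ x ]) ≟ 0
  ... | yes sx∈ = sx∈
  ... | no _    = child-∈ s s∈

  next-id : ∀ s x → InTree (s ++ [ x ]) → next s x ≡ x
  next-id s x sx∈ with β (s ++ [ x ]) ≟ 0
  ... | yes _   = refl
  ... | no sx∉  = ⊥-elim (sx∉ sx∈)

  retractFrom : Seq → Baire → Baire
  retractFrom s a zero    = next s (a 0)
  retractFrom s a (suc k) = retractFrom (s ++ [ next s (a 0) ]) (tail a) k

  retractFrom-∈ : ∀ s a → InTree s → ∀ n → InTree (s ++ initSeg (retractFrom s a) n)
  retractFrom-∈ s a s∈ zero    = subst InTree (sym (++-identityʳ s)) s∈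
  retractFrom-∈ s a s∈ (suc n) =
    subst InTree (++-assoc s [ next s (a 0) ] _)
      (retractFrom-∈ (s ++ [ next s (a 0) ]) (tail a) (next-∈ s (a 0) s∈) n)

  retractFrom-fixes : ∀ s α → (∀ n → InTree (s ++ initSeg α n)) → ∀ k → retractFrom s α k ≡ α k
  retractFrom-fixes s α path zero = next-id s (α 0) (path 1)
  retractFrom-fixes s α path (suc k) rewrite next-id s (α 0) (path 1) =
    retractFrom-fixes (s ++ [ α 0 ]) (tail α)
      (λ n → subst InTree (sym (++-assoc s [ α 0 ] _)) (path (suc n))) k

  retractFrom-causal : ∀ s a b n → initSeg a n ≡ initSeg b n →
                       initSeg (retractFrom s a) n ≡ initSeg (retractFrom s b) n
  retractFrom-causal s a b zero    _ = refl
  retractFrom-causal s a b (suc n) e rewrite ∷-injectiveˡ e =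
    cong (next s (b 0) ∷_)
      (retractFrom-causal (s ++ [ next s (b 0) ]) (tail a) (tail b) n (∷-injectiveʳ e))

module HitBar (β : Seq → ℕ) (spread : SpreadLaw β) (δ : ℕ → Baire) where
  open Retraction β spread

  decode : Seq → Baire
  decode s = retractFrom [] (λ k → first (pad s k))

  HitAt : Seq → ℕ → ℕ → Set
  HitAt s j c = second c ≤ length s × initSeg (decode s) (second c) ≡ initSeg (δ j) (second c)

  Hit : Seq → ℕ → Set
  Hit s j = HitAt s j (pad s j)

  hit? : ∀ s j → Dec (Hit s j)
  hit? s j = (second (pad s j) ≤? length s) ×-dec ≡-dec _≟_ _ _

  B : Seq → ℕ
  B s = zeroIf (anyUpTo? (hit? s) (length s))

  B-bar : InTree [] → (∀ α → F β α → Almost* δ α) → Bar B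
  B-bar []∈ almost ε = n , zeroIf-complete (anyUpTo? (hit? full) (length full)) (i , i<|full| , hit)
    where
    a : Baire
    a k = first (ε k)
    α′ : Baire
    α′ = retractFrom [] a
    α′-almost : Almost* δ α′
    α′-almost = almost α′ (retractFrom-∈ [] a []∈)
    i = proj₁ (α′-almost (λ k → second (ε k)))
    g = second (ε i)
    n = suc (i + g)
    full = initSeg ε n
    i<n : i < n
    i<n = s≤s (m≤m+n i g)
    g≤n : g ≤ n
    g≤n = ≤-trans (m≤n+m g i) (n≤1+n _)
    i<|full| : i < length full
    i<|full| = subst (i <_) (sym (length-initSeg ε n)) i<n
    decode-full : initSeg (decode full) g ≡ initSeg α′ g
    decode-full = initSeg-shorten (decode full) α′ g≤n
      (retractFrom-causal [] (λ k → first (pad full k)) a n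
        (initSeg-cong n (λ k k<n → cong first (pad-initSeg ε k<n))))
    hit : Hit full i
    hit = subst (HitAt full i) (sym (pad-initSeg ε i<n))
      ( subst (g ≤_) (sym (length-initSeg ε n)) g≤n
      , trans decode-full (proj₂ (α′-almost (λ k → second (ε k)))))

  Entry : Baire → ℕ → ℕ → Set
  Entry α j c = first c ≡ α j × initSeg α (second c) ≢ initSeg (δ j) (second c)

  Good : Baire → Seq → Set
  Good α h = ∀ j → j < length h → Entry α j (pad h j)

  Good-snoc : ∀ {α h m} → Good α h → Entry α (length h) m → Good α (h ++ [ m ])
  Good-snoc {α} {h} {m} good new j j< with m<1+n⇒m<n∨m≡n (subst (j <_) (length-snoc h m) j<)
  ... | inj₁ j<h  = subst (Entry α j) (sym (pad-++ h [ m ] j<h)) (good j j<h)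
  ... | inj₂ refl = subst (Entry α (length h)) (sym (pad-snoc h m)) new

  apart⇒Entry : ∀ {α j p} → α p ≢ δ j p → Entry α j (pair (α j) (suc p))
  apart⇒Entry {α} {j} {p} αₚ≢ rewrite unpair-pair (α j) (suc p) =
    refl , λ agree → αₚ≢ (initSeg-agree α (δ j) agree ≤-refl)

  Good⇒decode : ∀ {α h} → F β α → Good α h → initSeg (decode h) (length h) ≡ initSeg α (length h)
  Good⇒decode {α} Fα good =
    trans (retractFrom-causal [] _ α _ (initSeg-cong _ (λ j j< → proj₁ (good j j<))))
          (initSeg-cong _ (λ k _ → retractFrom-fixes [] α Fα k))

  Good⇒B≢0 : ∀ {α h} → F β α → Good α h → B h ≢ 0
  Good⇒B≢0 {α} {h} Fα good B≡0
    with j , j< , g≤ , hit ← zeroIf-sound (anyUpTo? (hit? h) (length h)) B≡0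
    = proj₂ (good j j<)
        (trans (sym (initSeg-shorten (decode h) α g≤ (Good⇒decode {α} {h} Fα good))) hit)

  measures-above-^ : ∀ {τ} h → B h ≢ 0 → ∀ m →
                     Measures τ (λ s → B (h ++ s)) → Measures (τ ^ m) (λ s → B ((h ++ [ m ]) ++ s))
  measures-above-^ {τ} h Bh≢0 m K =
    measures-resp {τ ^ m} {λ s → B (h ++ m ∷ s)} (λ s → cong B (sym (++-assoc h [ m ] s)))
      (measures-^ {τ} {λ s → B (h ++ s)} K
        (λ B≡0 → Bh≢0 (trans (cong B (sym (++-identityʳ h))) B≡0)) m)

  ℙ-from-Good : ∀ {α} → F β α → ∀ {h} → Good α h →
                ∀ {τ} (T : Stp τ) → Measures τ (λ s → B (h ++ s)) → ℙ τ T (En δ) α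
  ℙ-from-Good Fα {h} good {τ} (empty τ≢0) K = ⊥-elim (τ≢0 (measures-root {τ} {λ s → B (h ++ s)} K))
  ℙ-from-Good {α} Fα {h} good {τ} (nonempty _ T) K =
    δ (length h) , (length h , λ _ → refl) , λ (p , αₚ≢) →
      let m = pair (α (length h)) (suc p) in
      m , ℙ-from-Good Fα {h ++ [ m ]} (Good-snoc {α} {h} good (apart⇒Entry {α} {length h} αₚ≢)) (T m)
            (measures-above-^ {τ} h (Good⇒B≢0 {α} {h} Fα good) m K)

spread⇒ℙ : BrouwerThesis → ∀ (β : Seq → ℕ) (δ : ℕ → Baire) → SpreadLaw β →
           (∀ α → F β α → Almost* δ α) →
           Σ (Seq → ℕ) (λ τ → Σ (Stp τ) (λ T → ∀ α → F β α → ℙ τ T (En δ) α))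
spread⇒ℙ bt β δ spread almost with β [] ≟ 0
... | no []∉ = (λ _ → 1) , empty (λ ()) , λ α Fα → ⊥-elim ([]∉ (Fα 0))
... | yes []∈ =
  let open HitBar β spread δ
      τ , T , K = bt B (B-bar []∈ almost)
  in τ , T , λ α Fα → ℙ-from-Good Fα {[]} (λ _ ()) T K

pointLaw : Baire → Seq → ℕ
pointLaw α s = zeroIf (≡-dec _≟_ s (initSeg α (length s)))

pointLaw-sound : ∀ α s → pointLaw α s ≡ 0 → s ≡ initSeg α (length s)
pointLaw-sound α s = zeroIf-sound (≡-dec _≟_ s (initSeg α (length s)))

pointLaw-complete : ∀ α s → s ≡ initSeg α (length s) → pointLaw α s ≡ 0
pointLaw-complete α s = zeroIf-complete (≡-dec _≟_ s (initSeg α (length s)))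

pointLaw-spread : ∀ α → SpreadLaw (pointLaw α)
pointLaw-spread α s = extend , restrict
  where
  extend : pointLaw α s ≡ 0 → Σ ℕ (λ n → pointLaw α (s ++ [ n ]) ≡ 0)
  extend s≡ = α (length s) , pointLaw-complete α _
    (trans (cong (_++ [ α (length s) ]) (pointLaw-sound α s s≡))
      (trans (initSeg-snoc α (length s)) (cong (initSeg α) (sym (length-snoc s _)))))
  restrict : Σ ℕ (λ n → pointLaw α (s ++ [ n ]) ≡ 0) → pointLaw α s ≡ 0
  restrict (n , sn≡) = pointLaw-complete α s (∷ʳ-injectiveˡ s (initSeg α (length s))
    (trans (pointLaw-sound α _ sn≡)
      (trans (cong (initSeg α) (length-snoc s n)) (sym (initSeg-snoc α (length s))))))

F-pointLaw : ∀ α → F (pointLaw α) α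
F-pointLaw α n = pointLaw-complete α _ (cong (initSeg α) (sym (length-initSeg α n)))

F-pointLaw⇒initSeg : ∀ {α α′} → F (pointLaw α) α′ → ∀ n → initSeg α′ n ≡ initSeg α n
F-pointLaw⇒initSeg {α} {α′} Fα′ n =
  trans (pointLaw-sound α _ (Fα′ n)) (cong (initSeg α) (length-initSeg α′ n))

Almost*-resp : ∀ {δ α α′} → (∀ n → initSeg α′ n ≡ initSeg α n) → Almost* δ α → Almost* δ α′
Almost*-resp α′≈α almost γ with n , agree ← almost γ = n , trans (α′≈α (γ n)) agree

Almost*⇒ℙ : BrouwerThesis → ∀ (δ : ℕ → Baire) (α : Baire) → Almost* δ α →
            Σ (Seq → ℕ) (λ σ → Σ (Stp σ) (λ S → ℙ σ S (En δ) α))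
Almost*⇒ℙ bt δ α almost
  with τ , T , P ← spread⇒ℙ bt (pointLaw α) δ (pointLaw-spread α)
                     (λ α′ Fα′ → Almost*-resp (F-pointLaw⇒initSeg Fα′) almost)
  = τ , T , P α (F-pointLaw α)

theorem9p3 : BrouwerThesis →
    (∀ (σ : Seq → ℕ) (S : Stp σ) (δ : ℕ → Baire) (α : Baire) →
       Secures σ δ α → ℙ σ S (En δ) α)
    × (∀ (δ : ℕ → Baire) (α : Baire) → Almost* δ α →
       Σ (Seq → ℕ) (λ σ → Σ (Stp σ) (λ S → ℙ σ S (En δ) α)))
    × (∀ (δ : ℕ → Baire) (α : Baire) →
       (Almost* δ α → Σ (Seq → ℕ) (λ σ → Σ (Stp σ) (λ S → ℙ σ S (En δ) α)))
       × (Σ (Seq → ℕ) (λ σ → Σ (Stp σ) (λ S → ℙ σ S (En δ) α)) → Almost* δ α))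
    × (∀ (β : Seq → ℕ) (δ : ℕ → Baire) → SpreadLaw β →
       (∀ α → F β α → Almost* δ α) →
       Σ (Seq → ℕ) (λ τ → Σ (Stp τ) (λ T → ∀ α → F β α → ℙ τ T (En δ) α)))
    × (∀ (β : Seq → ℕ) →
       (ACS β → Σ (Seq → ℕ) (λ σ → Σ (Stp σ) (λ S → PCS σ S β)))
       × (Σ (Seq → ℕ) (λ σ → Σ (Stp σ) (λ S → PCS σ S β)) → ACS β))
theorem9p3 bt =
    (λ σ S δ α → secures⇒ℙ S)
  , Almost*⇒ℙ bt
  , (λ δ α → Almost*⇒ℙ bt δ α , λ (σ , S , P) → ℙ⇒Almost* S P)
  , spread⇒ℙ bt
  , λ β → (λ (spread , δ , almost) →
              let τ , T , P = spread⇒ℙ bt β δ spread almost in τ , T , spread , δ , P)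
        , (λ (σ , S , spread , δ , P) → spread , δ , λ α Fα → ℙ⇒Almost* S (P α Fα))
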